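{- The map $r:\mathcal D_{n,m,\sigma}\to\mathcal R_{n,m,\sigma}$ is a bijection.
   Context: For a positive integer $k$, $[k]=\{1,\dots,k\}$. A DFA is a triple $D=(Q,\Sigma,\delta)$ with $Q=[n]$, source state $1$, alphabet $\Sigma=[\sigma]$ ordered as integers, and partial transition function $\delta:Q\times\Sigma\to Q$; $m$ is the number of pairs on which $\delta$ is defined. DFAs are assumed to satisfy: state $v$ has an incoming transition iff $v>1$. A WDFA (w.r.t. order $1<\dots<n$) satisfies: (i) if $u'=\delta(u,a)$, $v'=\delta(v,a')$ and $a<a'$ then $u'<v'$; (ii) if $u'=\delta(u,a)\ne\delta(v,a)=v'$ and $u<v$ then $u'<v'$. $\mathcal D_{n,m,\sigma}$ is the set of WDFAs with states $[n]$, $m$ transitions, effective alphabet $[\sigma]$ (every letter labels some transition), and Wheeler order $1<\dots<n$. Standing assumptions: $n-1\le m\le n\sigma$, $\sigma\le n-1$. For a 0/1 vector $x$, $\|x\|$ is its number of ones; for a 0/1 matrix $A$, $A_j$ is its $j$-th column and $\|A\|$ its number of ones. Let $\mathcal O_{n,\sigma,m}=\{O\in\{0,1\}^{n\times\sigma}:\|O\|=m,\ \|O_j\|\ge1\ \forall j\in[\sigma]\}$, $\mathcal I_{m,n}=\{I\in\{0,1\}^m:\|I\|=n-1\}$, for $O\in\mathcal O_{n,\sigma,m}$ let $\mathcal I_O=\{I\in\mathcal I_{m,n}: I_{1+\sum_{k=1}^{j-1}\|O_k\|}=1\ \forall j\in[\sigma]\}$, and $\mathcal R_{n,m,\sigma}=\{(O,I):O\in\mathcal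 O_{n,\sigma,m},\ I\in\mathcal I_O\}$. For $D\in\mathcal D_{n,m,\sigma}$, $r(D)=(O,I)$ where $O_{u,j}=1$ iff $\delta(u,j)$ is defined, and $I$ is the concatenation over $v=2,\dots,n$ (in order) of a single $1$ followed by $|\delta^{in}(v)|-1$ zeros, where $\delta^{in}(v)=\{u:\exists j,\ \delta(u,j)=v\}$. -}

module Defs where

open import Data.Nat using (ℕ; zero; suc; _+_; _∸_; _≤_; _<_)
open import Data.Bool using (Bool; true; false)
open import Data.Fin as F using (Fin; toℕ)
open import Data.Maybe using (Maybe; just; nothing; is-just)
open import Data.Maybe.Properties using (≡-dec)
import Data.Fin.Properties as FP
open import Data.Vec as V using (Vec; []; _∷_)
open import Data.List as L using (List)
import Data.Product
import Data.Bool.ListAction as BLA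
import Data.Nat.ListAction as NLA
open import Data.Product using (Σ; ∃; ∃-syntax; _×_; _,_)
open import Relation.Nullary using (¬_)
open import Relation.Nullary.Decidable using (⌊_⌋)
open import Relation.Binary.PropositionalEquality using (_≡_; _≢_)

-- States [n] are represented by Fin n (Fin index 0 = state 1 = the source),
-- letters [σ] by Fin σ (index 0 = letter 1).  The Wheeler order 1<…<n is the
-- natural order on Fin n; the letter order is the natural order on Fin σ.

Table : ℕ → ℕ → Set
Table n σ = Vec (Vec (Maybe (Fin n)) σ) n

δ : ∀ {n σ} → Table n σ → Fin n → Fin σ → Maybe (Fin n)
δ T u a = V.lookup (V.lookup T u) a

ones : ∀ {k} → Vec Bool k → ℕ
ones [] = 0
ones (true ∷ xs) = suc (ones xs)
ones (false ∷ xs) = ones xs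

onesL : List Bool → ℕ
onesL L.[] = 0
onesL (true L.∷ xs) = suc (onesL xs)
onesL (false L.∷ xs) = onesL xs

onesM : ∀ {n σ} → Vec (Vec Bool σ) n → ℕ
onesM [] = 0
onesM (row ∷ rows) = ones row + onesM rows

column : ∀ {n σ} → Vec (Vec Bool σ) n → Fin σ → Vec Bool n
column O j = V.map (λ row → V.lookup row j) O

nTrans : ∀ {n σ} → Table n σ → ℕ
nTrans T = onesM (V.map (V.map is-just) T)

record IsWDFA (n m σ : ℕ) (T : Table n σ) : Set where
  field
    transitions : nTrans T ≡ m
    effective : ∀ (a : Fin σ) → ∃[ u ] ∃[ v ] (δ T u a ≡ just v)
    -- state v has an incoming transition iff v > 1 (i.e. v is not the source)
    incoming⇒ : ∀ (v : Fin n) → (∃[ u ] ∃[ a ] (δ T u a ≡ just v)) → toℕ v ≢ 0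
    incoming⇐ : ∀ (v : Fin n) → toℕ v ≢ 0 → ∃[ u ] ∃[ a ] (δ T u a ≡ just v)
    wheeler-i : ∀ (u v u' v' : Fin n) (a a' : Fin σ) →
      δ T u a ≡ just u' → δ T v a' ≡ just v' → a F.< a' → u' F.< v'
    wheeler-ii : ∀ (u v u' v' : Fin n) (a : Fin σ) →
      δ T u a ≡ just u' → δ T v a ≡ just v' → u' ≢ v' → u F.< v → u' F.< v'

edgeB : ∀ {n σ} → Table n σ → Fin n → Fin n → Bool
edgeB {n} {σ} T u v = BLA.any (λ a → ⌊ ≡-dec FP._≟_ (δ T u a) (just v) ⌋) (L.allFin σ)

inDeg : ∀ {n σ} → Table n σ → Fin n → ℕ
inDeg {n} T v = onesL (L.map (λ u → edgeB T u v) (L.allFin n))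

rO : ∀ {n σ} → Table n σ → Vec (Vec Bool σ) n
rO T = V.map (V.map is-just) T

rI : ∀ {n σ} → Table n σ → List Bool
rI {n} T = L.concatMap (λ v → true L.∷ L.replicate (inDeg T v ∸ 1) false) (L.drop 1 (L.allFin n))

r : ∀ {n σ} → Table n σ → Vec (Vec Bool σ) n × List Bool
r T = rO T , rI T

-- ∑_{k<j} ‖O_k‖  (j 0-indexed)
prefixCols : ∀ {n σ} → Vec (Vec Bool σ) n → Fin σ → ℕ
prefixCols {n} {σ} O j = NLA.sum (L.map (λ k → ones (column O k)) (L.take (toℕ j) (L.allFin σ)))

OneAt : List Bool → ℕ → Set
OneAt I p = Σ (Fin (L.length I)) λ i → (toℕ i ≡ p) × (L.lookup I i ≡ true)

record IsR (n m σ : ℕ) (R : Vec (Vec Bool σ) n × List Bool) : Set where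
  O = Data.Product.proj₁ R
  I = Data.Product.proj₂ R
  field
    O-ones : onesM O ≡ m
    O-cols : ∀ (j : Fin σ) → 1 ≤ ones (column O j)
    I-length : L.length I ≡ m
    I-ones : onesL I ≡ n ∸ 1
    -- I ∈ ℐ_O : I_{1+∑_{k<j}‖O_k‖} = 1 (1-indexed), i.e. position ∑_{k<j}‖O_k‖ 0-indexed
    I-O : ∀ (j : Fin σ) → OneAt I (prefixCols O j)

-- List the transitions letter by letter and, within a letter, by source
-- state.  The two Wheeler axioms say exactly that the targets then appear in
-- nondecreasing order; since every state v > 1 is a target and the source is
-- not, the target list is 2 … 2 3 … 3 … n … n, with v repeated |δ^in(v)| times
-- (the states of δ^in(v) reach v by distinct letters, by axiom (i)).  The
-- vector I marks the positions where this list increases, and O marks which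
-- slots are occupied, so (O, I) records the target list slot by slot: r is
-- injective.  Conversely any (O, I) ∈ ℛ decodes to a nondecreasing list that
-- can be written into the slots of O; axiom (ii) holds by sortedness, and
-- axiom (i) because I has a 1 at the first slot of each letter, i.e. the list
-- strictly increases at every letter boundary.
module Submission where

open import Data.Bool using (Bool; true; false; not)
open import Data.Bool.ListAction using (any)
open import Data.Bool.Properties using (not-¬)
open import Data.Empty using (⊥-elim)
open import Data.Fin as F using (Fin; toℕ)
import Data.Fin.Properties as FP
open import Data.List as L using (List; []; _∷_; _++_)
import Data.List.Properties as LP
open import Data.List.Membership.Propositional using (_∈_)
import Data.List.Membership.Propositional.Properties as MP
open import Data.List.Relation.Unary.All as All using (All; []; _∷_)
import Data.List.Relation.Unary.All.Properties as AllP
open import Data.List.Relation.Unary.AllPairs as AllPairs using (AllPairs; []; _∷_)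
import Data.List.Relation.Unary.AllPairs.Properties as APP
open import Data.List.Relation.Unary.Any using (here; there)
open import Data.Maybe using (Maybe; just; nothing; is-just)
open import Data.Maybe.Properties using (≡-dec; just-injective)
open import Data.Nat using (ℕ; zero; suc; _+_; _∸_; _*_; _≤_; _<_; z≤n; s≤s; _≟_)
open import Data.Nat.ListAction using (sum)
import Data.Nat.ListAction.Properties as NLAP
open import Data.Nat.Properties
open import Algebra.Properties.CommutativeSemigroup +-commutativeSemigroup using (interchange)
open import Data.Product using (Σ; ∃-syntax; _×_; _,_; proj₁; proj₂; map₁)
open import Data.Product.Relation.Binary.Lex.Strict using (×-Lex; ×-irreflexive; ×-asymmetric)
open import Data.Sum using (_⊎_; inj₁; inj₂)
import Data.Vec as V
import Data.Vec.Properties as VP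
open import Data.Vec.Relation.Binary.Pointwise.Extensional using (ext; Pointwise-≡⇒≡)
open import Function.Bundles using (mk⇔)
open import Relation.Binary.Definitions using (tri<; tri≈; tri>)
open import Relation.Binary.PropositionalEquality
open import Relation.Nullary using (¬_; yes; no)
open import Relation.Nullary.Decidable using (Dec; ⌊_⌋; isYes≗does; dec-true; dec-false; does-⇔)

open import Defs

⌊⌋-true : ∀ {A : Set} (a? : Dec A) → A → ⌊ a? ⌋ ≡ true
⌊⌋-true a? a = trans (isYes≗does a?) (dec-true a? a)

⌊⌋-false : ∀ {A : Set} (a? : Dec A) → ¬ A → ⌊ a? ⌋ ≡ false
⌊⌋-false a? ¬a = trans (isYes≗does a?) (dec-false a? ¬a)

bit : Bool → ℕ
bit true = 1
bit false = 0

count : ℕ → List ℕ → ℕ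
count i [] = 0
count i (x ∷ xs) = bit ⌊ i ≟ x ⌋ + count i xs

count-++ : ∀ i xs ys → count i (xs ++ ys) ≡ count i xs + count i ys
count-++ i [] ys = refl
count-++ i (x ∷ xs) ys = trans (cong (bit ⌊ i ≟ x ⌋ +_) (count-++ i xs ys)) (sym (+-assoc (bit ⌊ i ≟ x ⌋) _ _))

count-absent : ∀ i xs → All (i ≢_) xs → count i xs ≡ 0
count-absent i [] [] = refl
count-absent i (x ∷ xs) (i≢x ∷ i∉xs) with i ≟ x
... | yes i≡x = ⊥-elim (i≢x i≡x)
... | no _ = count-absent i xs i∉xs

count-∈ : ∀ {i} xs → i ∈ xs → 1 ≤ count i xs
count-∈ {i} (x ∷ xs) (here refl) = subst (λ b → 1 ≤ bit b + count i xs) (sym (⌊⌋-true (i ≟ i) refl)) (s≤s z≤n)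
count-∈ {i} (x ∷ xs) (there i∈xs) = ≤-trans (count-∈ xs i∈xs) (m≤n+m (count i xs) (bit ⌊ i ≟ x ⌋))

Sorted : List ℕ → Set
Sorted = AllPairs _≤_

sorted-++⁻ : ∀ xs ys → Sorted (xs ++ ys) → Sorted xs × Sorted ys × All (λ x → All (x ≤_) ys) xs
sorted-++⁻ [] ys s = [] , s , []
sorted-++⁻ (x ∷ xs) ys (x≤ ∷ s) =
  let sxs , sys , xs≤ys = sorted-++⁻ xs ys s
  in AllP.++⁻ˡ xs x≤ ∷ sxs , sys , AllP.++⁻ʳ xs x≤ ∷ xs≤ys

replicate-sorted : ∀ c k → Sorted (L.replicate c k)
replicate-sorted zero k = []
replicate-sorted (suc c) k = AllP.replicate⁺ c ≤-refl ∷ replicate-sorted c k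

sorted-split-min : ∀ k xs → Sorted xs → All (k ≤_) xs →
  ∃[ ys ] xs ≡ L.replicate (count k xs) k ++ ys × All (k <_) ys × Sorted ys
sorted-split-min k [] _ _ = [] , refl , [] , []
sorted-split-min k (x ∷ xs) (x≤xs ∷ s) (k≤x ∷ k≤xs) with k ≟ x
... | yes refl =
  let ys , eq , k<ys , sys = sorted-split-min k xs s k≤xs in ys , cong (k ∷_) eq , k<ys , sys
... | no k≢x =
  x ∷ xs , cong (λ c → L.replicate c k ++ x ∷ xs) (sym (count-absent k xs (All.map <⇒≢ k<xs))) ,
  k<x ∷ k<xs , x≤xs ∷ s
  where
  k<x : k < x
  k<x = ≤∧≢⇒< k≤x k≢x
  k<xs : All (k <_) xs
  k<xs = All.map (<-≤-trans k<x) x≤xs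

interval : ℕ → ℕ → List ℕ
interval k zero = []
interval k (suc d) = k ∷ interval (suc k) d

tabulate-interval : ∀ {A : Set} k d (g : ℕ → A) → L.tabulate (λ (i : Fin d) → g (k + toℕ i)) ≡ L.map g (interval k d)
tabulate-interval k zero g = refl
tabulate-interval k (suc d) g = cong₂ _∷_ (cong g (+-identityʳ k))
  (trans (LP.tabulate-cong (λ i → cong g (+-suc k (toℕ i)))) (tabulate-interval (suc k) d g))

map-interval-cong : ∀ {f g : ℕ → ℕ} k d → (∀ i → k ≤ i → f i ≡ g i) → L.map f (interval k d) ≡ L.map g (interval k d)
map-interval-cong k zero f≗g = refl
map-interval-cong k (suc d) f≗g = cong₂ _∷_ (f≗g k ≤-refl) (map-interval-cong (suc k) d (λ i k<i → f≗g i (<⇒≤ k<i)))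

runs : ℕ → List ℕ → List ℕ
runs k [] = []
runs k (c ∷ cs) = L.replicate (suc c) k ++ runs (suc k) cs

sorted-covering⇒runs : ∀ d k xs → Sorted xs → All (λ x → k ≤ x × x < k + d) xs →
  (∀ i → k ≤ i → i < k + d → 1 ≤ count i xs) →
  xs ≡ runs k (L.map (λ i → count i xs ∸ 1) (interval k d))
sorted-covering⇒runs zero k [] _ _ _ = refl
sorted-covering⇒runs zero k (x ∷ xs) _ ((k≤x , x<k+0) ∷ _) _ =
  ⊥-elim (<-irrefl refl (≤-<-trans k≤x (subst (x <_) (+-identityʳ k) x<k+0)))
sorted-covering⇒runs (suc d) k xs s bounded covers with sorted-split-min k xs s (All.map proj₁ bounded)
... | ys , xs≡ks++ys , k<ys , sys = trans xs≡ks++ys (cong₂ _++_ (cong (λ c → L.replicate c k) c≡1+c-1) ys≡runs)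
  where
  c : ℕ
  c = count k xs
  c≡1+c-1 : c ≡ suc (c ∸ 1)
  c≡1+c-1 = sym (m+[n∸m]≡n (covers k ≤-refl (subst (k <_) (sym (+-suc k d)) (s≤s (m≤m+n k d)))))
  count-above : ∀ i → suc k ≤ i → count i xs ≡ count i ys
  count-above i k<i = trans (cong (count i) xs≡ks++ys) (trans (count-++ i (L.replicate c k) ys)
    (cong (_+ count i ys) (count-absent i _ (AllP.replicate⁺ c (λ i≡k → <-irrefl (sym i≡k) k<i)))))
  ys-bounded : All (λ y → suc k ≤ y × y < suc k + d) ys
  ys-bounded = All.zipWith (λ { {y} (k<y , _ , y<k+1+d) → k<y , subst (y <_) (+-suc k d) y<k+1+d })
    (k<ys , AllP.++⁻ʳ (L.replicate c k) (subst (All _) xs≡ks++ys bounded))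
  ys≡runs : ys ≡ runs (suc k) (L.map (λ i → count i xs ∸ 1) (interval (suc k) d))
  ys≡runs = trans
    (sorted-covering⇒runs d (suc k) ys sys ys-bounded
      (λ i k<i i<k+1+d → subst (1 ≤_) (count-above i k<i) (covers i (<⇒≤ k<i) (subst (i <_) (sym (+-suc k d)) i<k+1+d))))
    (cong (runs (suc k)) (map-interval-cong (suc k) d (λ i k<i → cong (_∸ 1) (sym (count-above i k<i)))))

runs-bounded : ∀ k cs → All (λ x → k ≤ x × x < k + L.length cs) (runs k cs)
runs-bounded k [] = []
runs-bounded k (c ∷ cs) = AllP.++⁺
  (AllP.replicate⁺ (suc c) (≤-refl , subst (k <_) (sym (+-suc k (L.length cs))) (s≤s (m≤m+n k _))))
  (All.map (λ {x} (k<x , x<) → <⇒≤ k<x , subst (x <_) (sym (+-suc k (L.length cs))) x<) (runs-bounded (suc k) cs))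

runs-covers : ∀ k cs i → k ≤ i → i < k + L.length cs → i ∈ runs k cs
runs-covers k [] i k≤i i<k+0 = ⊥-elim (<-irrefl refl (≤-<-trans k≤i (subst (i <_) (+-identityʳ k) i<k+0)))
runs-covers k (c ∷ cs) i k≤i i< with k ≟ i
... | yes refl = here refl
... | no k≢i = MP.∈-++⁺ʳ (L.replicate (suc c) k)
  (runs-covers (suc k) cs i (≤∧≢⇒< k≤i k≢i) (subst (i <_) (+-suc k (L.length cs)) i<))

runs-sorted : ∀ k cs → Sorted (runs k cs)
runs-sorted k [] = []
runs-sorted k (c ∷ cs) = APP.++⁺ (replicate-sorted (suc c) k) (runs-sorted (suc k) cs)
  (AllP.replicate⁺ (suc c) (All.map (λ (k<x , _) → <⇒≤ k<x) (runs-bounded (suc k) cs)))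

-- Run-length codes (rI T is blocks of the in-degrees minus one)

blocks : List ℕ → List Bool
blocks [] = []
blocks (c ∷ cs) = true ∷ L.replicate c false ++ blocks cs

decodeRuns : ℕ → List Bool → List ℕ
decodeRuns k [] = []
decodeRuns k (true ∷ bs) = suc k ∷ decodeRuns (suc k) bs
decodeRuns k (false ∷ bs) = k ∷ decodeRuns k bs

changes : ℕ → List ℕ → List Bool
changes p [] = []
changes p (y ∷ ys) = not ⌊ p ≟ y ⌋ ∷ changes y ys

decodeRuns-blocks : ∀ k cs → decodeRuns k (blocks cs) ≡ runs (suc k) cs
decodeRuns-blocks k [] = refl
decodeRuns-blocks k (c ∷ cs) = cong (suc k ∷_) (replicate-step c)
  where
  replicate-step : ∀ c → decodeRuns (suc k) (L.replicate c false ++ blocks cs) ≡ L.replicate c (suc k) ++ runs (suc (suc k)) cs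
  replicate-step zero = decodeRuns-blocks (suc k) cs
  replicate-step (suc c) = cong (suc k ∷_) (replicate-step c)

changes-runs : ∀ k cs → changes k (runs (suc k) cs) ≡ blocks cs
changes-runs k [] = refl
changes-runs k (c ∷ cs) = cong₂ _∷_ (cong not (⌊⌋-false (k ≟ suc k) (<⇒≢ ≤-refl))) (replicate-step c)
  where
  replicate-step : ∀ c → changes (suc k) (L.replicate c (suc k) ++ runs (suc (suc k)) cs) ≡ L.replicate c false ++ blocks cs
  replicate-step zero = changes-runs (suc k) cs
  replicate-step (suc c) = cong₂ _∷_ (cong not (⌊⌋-true (suc k ≟ suc k) refl)) (replicate-step c)

lastOr : ℕ → List ℕ → ℕ
lastOr d [] = d
lastOr d (x ∷ xs) = lastOr x xs

lastOr-All : ∀ {P : ℕ → Set} d xs → P d → All P xs → P (lastOr d xs)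
lastOr-All d [] pd [] = pd
lastOr-All d (x ∷ xs) pd (px ∷ pxs) = lastOr-All x xs px pxs

≤-lastOr : ∀ d xs {x} → Sorted xs → x ∈ xs → x ≤ lastOr d xs
≤-lastOr d (y ∷ ys) (y≤ys ∷ s) (here refl) = lastOr-All y ys ≤-refl y≤ys
≤-lastOr d (y ∷ ys) (y≤ys ∷ s) (there x∈ys) = ≤-lastOr y ys s x∈ys

changes-++ : ∀ p xs y ys → changes p (xs ++ y ∷ ys) ≡ changes p xs ++ not ⌊ lastOr p xs ≟ y ⌋ ∷ changes y ys
changes-++ p [] y ys = refl
changes-++ p (x ∷ xs) y ys = cong (_ ∷_) (changes-++ x xs y ys)

length-changes : ∀ p xs → L.length (changes p xs) ≡ L.length xs
length-changes p [] = refl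
length-changes p (x ∷ xs) = cong suc (length-changes x xs)

changed⇒≢ : ∀ p y → not ⌊ p ≟ y ⌋ ≡ true → p ≢ y
changed⇒≢ p y h p≡y = not-¬ (sym (⌊⌋-true (p ≟ y) p≡y)) (sym h)

OneAt-++⁺ : ∀ xs ys → OneAt (xs ++ true ∷ ys) (L.length xs)
OneAt-++⁺ [] ys = F.zero , refl , refl
OneAt-++⁺ (x ∷ xs) ys = let i , i≡ , lookup≡ = OneAt-++⁺ xs ys in F.suc i , cong suc i≡ , lookup≡

OneAt-++⁻ : ∀ xs b ys → OneAt (xs ++ b ∷ ys) (L.length xs) → b ≡ true
OneAt-++⁻ [] b ys (F.zero , _ , b≡true) = b≡true
OneAt-++⁻ (x ∷ xs) b ys (F.suc i , i≡ , lookup≡) = OneAt-++⁻ xs b ys (i , suc-injective i≡ , lookup≡)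

-- In a list of positive values split as A ++ B, the code changes 0 has a 1 at
-- position |A| exactly when the values strictly increase from A to B.

boundary⁺ : ∀ A B {y} → y ∈ B → All (λ b → 0 < b × All (_< b) A) B → OneAt (changes 0 (A ++ B)) (L.length A)
boundary⁺ A (b ∷ B) _ ((0<b , A<b) ∷ _) =
  subst₂ OneAt (trans (cong (λ c → changes 0 A ++ c ∷ changes b B) increase) (sym (changes-++ 0 A b B)))
    (length-changes 0 A) (OneAt-++⁺ (changes 0 A) (changes b B))
  where
  increase : true ≡ not ⌊ lastOr 0 A ≟ b ⌋
  increase = cong not (sym (⌊⌋-false (lastOr 0 A ≟ b) (<⇒≢ (lastOr-All 0 A 0<b A<b))))

boundary⁻ : ∀ A B → Sorted (A ++ B) → OneAt (changes 0 (A ++ B)) (L.length A) → All (λ b → All (_< b) A) B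
boundary⁻ A [] _ _ = []
boundary⁻ A (b ∷ B) s one with sorted-++⁻ A (b ∷ B) s
... | sA , b≤B ∷ _ , A≤bB = A<b ∷ All.map (λ b≤b' → All.map (λ x<b → <-≤-trans x<b b≤b') A<b) b≤B
  where
  last<b : lastOr 0 A < b
  last<b = ≤∧≢⇒< (lastOr-All 0 A z≤n (All.map All.head A≤bB))
    (changed⇒≢ _ b (OneAt-++⁻ (changes 0 A) _ (changes b B)
      (subst₂ OneAt (changes-++ 0 A b B) (sym (length-changes 0 A)) one)))
  A<b : All (_< b) A
  A<b = All.tabulate (λ x∈A → ≤-<-trans (≤-lastOr 0 A sA x∈A) last<b)

length-blocks : ∀ k cs → L.length (blocks cs) ≡ L.length (runs k cs)
length-blocks k [] = refl
length-blocks k (c ∷ cs) = cong suc (begin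
  L.length (L.replicate c false ++ blocks cs)     ≡⟨ LP.length-++ (L.replicate c false) ⟩
  L.length (L.replicate c false) + L.length (blocks cs)
    ≡⟨ cong₂ _+_ (trans (LP.length-replicate c) (sym (LP.length-replicate c))) (length-blocks (suc k) cs) ⟩
  L.length (L.replicate c k) + L.length (runs (suc k) cs)  ≡⟨ LP.length-++ (L.replicate c k) ⟨
  L.length (L.replicate c k ++ runs (suc k) cs)   ∎)
  where open ≡-Reasoning

onesL-blocks : ∀ cs → onesL (blocks cs) ≡ L.length cs
onesL-blocks [] = refl
onesL-blocks (c ∷ cs) = cong suc (trans (skip-falses c) (onesL-blocks cs))
  where
  skip-falses : ∀ c → onesL (L.replicate c false ++ blocks cs) ≡ onesL (blocks cs)
  skip-falses zero = refl
  skip-falses (suc c) = skip-falses c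

true∷⇒blocks : ∀ bs → ∃[ c ] ∃[ cs ] true ∷ bs ≡ blocks (c ∷ cs)
true∷⇒blocks [] = 0 , [] , refl
true∷⇒blocks (true ∷ bs) = let c , cs , eq = true∷⇒blocks bs in 0 , c ∷ cs , cong (true ∷_) eq
true∷⇒blocks (false ∷ bs) = let c , cs , eq = true∷⇒blocks bs in suc c , cs , cong (λ z → true ∷ false ∷ z) (LP.∷-injectiveʳ eq)

values : ∀ {n} → List (Maybe (Fin n)) → List ℕ
values [] = []
values (nothing ∷ xs) = values xs
values (just x ∷ xs) = toℕ x ∷ values xs

values-++ : ∀ {n} (xs ys : List (Maybe (Fin n))) → values (xs ++ ys) ≡ values xs ++ values ys
values-++ [] ys = refl
values-++ (nothing ∷ xs) ys = values-++ xs ys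
values-++ (just x ∷ xs) ys = cong (toℕ x ∷_) (values-++ xs ys)

OnJust : ∀ {n} → (ℕ → Set) → Maybe (Fin n) → Set
OnJust P mx = ∀ x → mx ≡ just x → P (toℕ x)

All-values : ∀ {n} {P : ℕ → Set} (xs : List (Maybe (Fin n))) → All (OnJust P) xs → All P (values xs)
All-values [] [] = []
All-values (nothing ∷ xs) (_ ∷ ps) = All-values xs ps
All-values (just x ∷ xs) (px ∷ ps) = px x refl ∷ All-values xs ps

All-values⁻ : ∀ {n} {P : ℕ → Set} (xs : List (Maybe (Fin n))) → All P (values xs) → All (OnJust P) xs
All-values⁻ [] [] = []
All-values⁻ (nothing ∷ xs) ps = (λ _ ()) ∷ All-values⁻ xs ps
All-values⁻ (just x ∷ xs) (px ∷ ps) = (λ { _ refl → px }) ∷ All-values⁻ xs ps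

∈-values : ∀ {n} {x : Fin n} xs → just x ∈ xs → toℕ x ∈ values xs
∈-values (just _ ∷ xs) (here refl) = here refl
∈-values (nothing ∷ xs) (here ())
∈-values (nothing ∷ xs) (there x∈xs) = ∈-values xs x∈xs
∈-values (just _ ∷ xs) (there x∈xs) = there (∈-values xs x∈xs)

values-∈⁻ : ∀ {n i} (xs : List (Maybe (Fin n))) → i ∈ values xs → ∃[ x ] just x ∈ xs × toℕ x ≡ i
values-∈⁻ (nothing ∷ xs) i∈ = let x , x∈ , eq = values-∈⁻ xs i∈ in x , there x∈ , eq
values-∈⁻ (just y ∷ xs) (here refl) = y , here refl , refl
values-∈⁻ (just y ∷ xs) (there i∈) = let x , x∈ , eq = values-∈⁻ xs i∈ in x , there x∈ , eq

length-values : ∀ {n} (xs : List (Maybe (Fin n))) → L.length (values xs) ≡ sum (L.map (λ mx → bit (is-just mx)) xs)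
length-values [] = refl
length-values (nothing ∷ xs) = length-values xs
length-values (just x ∷ xs) = cong suc (length-values xs)

_pointsTo_ : ∀ {n} → Maybe (Fin n) → Fin n → Bool
mx pointsTo v = ⌊ ≡-dec FP._≟_ mx (just v) ⌋

pointsTo⇒≡ : ∀ {n} {mx : Maybe (Fin n)} {v} → mx pointsTo v ≡ true → mx ≡ just v
pointsTo⇒≡ {mx = mx} {v} h with ≡-dec FP._≟_ mx (just v)
... | yes mx≡v = mx≡v
pointsTo⇒≡ () | no _

count-values : ∀ {n} (v : Fin n) xs → count (toℕ v) (values xs) ≡ sum (L.map (λ mx → bit (mx pointsTo v)) xs)
count-values v [] = refl
count-values v (nothing ∷ xs) = count-values v xs
count-values v (just x ∷ xs) = cong₂ _+_ (cong bit same-decision) (count-values v xs)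
  where
  same-decision : ⌊ toℕ v ≟ toℕ x ⌋ ≡ just x pointsTo v
  same-decision = trans (isYes≗does _) (trans
    (does-⇔ (mk⇔ (λ v≡x → cong just (sym (FP.toℕ-injective v≡x))) (λ x≡v → cong toℕ (sym (just-injective x≡v))))
      (toℕ v ≟ toℕ x) (≡-dec FP._≟_ (just x) (just v)))
    (sym (isYes≗does _)))

_≤ᵐ_ : ∀ {n} → Maybe (Fin n) → Maybe (Fin n) → Set
mx ≤ᵐ my = ∀ x → mx ≡ just x → OnJust (toℕ x ≤_) my

values-sorted : ∀ {n} (xs : List (Maybe (Fin n))) → AllPairs _≤ᵐ_ xs → Sorted (values xs)
values-sorted [] [] = []
values-sorted (nothing ∷ xs) (_ ∷ s) = values-sorted xs s
values-sorted (just x ∷ xs) (x≤ ∷ s) = All-values xs (All.map (λ x≤y → x≤y x refl) x≤) ∷ values-sorted xs s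

values-sorted⁻ : ∀ {n} (xs : List (Maybe (Fin n))) → Sorted (values xs) → AllPairs _≤ᵐ_ xs
values-sorted⁻ [] [] = []
values-sorted⁻ (nothing ∷ xs) s = All.tabulate (λ _ _ ()) ∷ values-sorted⁻ xs s
values-sorted⁻ (just x ∷ xs) (x≤ ∷ s) = All.map (λ x≤y → λ { _ refl → x≤y }) (All-values⁻ xs x≤) ∷ values-sorted⁻ xs s

values-injective : ∀ {n} (xs ys : List (Maybe (Fin n))) →
  L.map is-just xs ≡ L.map is-just ys → values xs ≡ values ys → xs ≡ ys
values-injective [] [] _ _ = refl
values-injective (nothing ∷ xs) (nothing ∷ ys) p v = cong (nothing ∷_) (values-injective xs ys (LP.∷-injectiveʳ p) v)
values-injective (just x ∷ xs) (just y ∷ ys) p v = cong₂ _∷_ (cong just (FP.toℕ-injective (LP.∷-injectiveˡ v)))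
  (values-injective xs ys (LP.∷-injectiveʳ p) (LP.∷-injectiveʳ v))
values-injective (nothing ∷ xs) (just y ∷ ys) () _
values-injective (just x ∷ xs) (nothing ∷ ys) () _

module _ {A : Set} {R S : A → A → Set} (S-irrefl : ∀ {x} → ¬ S x x) (S-asym : ∀ {x y} → S x y → ¬ S y x) where

  AllPairs-respects : ∀ {xs x y} → AllPairs S xs → AllPairs R xs → x ∈ xs → y ∈ xs → S x y → R x y
  AllPairs-respects _ _ (here refl) (here refl) Sxx = ⊥-elim (S-irrefl Sxx)
  AllPairs-respects _ (Rx ∷ _) (here refl) (there y∈) _ = All.lookup Rx y∈
  AllPairs-respects (Sy ∷ _) _ (there x∈) (here refl) Sxy = ⊥-elim (S-asym Sxy (All.lookup Sy x∈))
  AllPairs-respects (_ ∷ Ss) (_ ∷ Rs) (there x∈) (there y∈) Sxy = AllPairs-respects Ss Rs x∈ y∈ Sxy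

map-≡⇒∈ : ∀ {A B : Set} {f g : A → B} {x} xs → L.map f xs ≡ L.map g xs → x ∈ xs → f x ≡ g x
map-≡⇒∈ (y ∷ xs) eq (here refl) = LP.∷-injectiveˡ eq
map-≡⇒∈ (y ∷ xs) eq (there x∈) = map-≡⇒∈ xs (LP.∷-injectiveʳ eq) x∈

sum-map-+ : ∀ {A : Set} (f g : A → ℕ) xs → sum (L.map (λ x → f x + g x) xs) ≡ sum (L.map f xs) + sum (L.map g xs)
sum-map-+ f g [] = refl
sum-map-+ f g (x ∷ xs) = trans (cong (f x + g x +_) (sum-map-+ f g xs)) (interchange (f x) (g x) _ _)

sum-map-0 : ∀ {A : Set} (xs : List A) → sum (L.map (λ _ → 0) xs) ≡ 0
sum-map-0 [] = refl
sum-map-0 (x ∷ xs) = sum-map-0 xs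

sum-swap : ∀ {A B : Set} (f : A → B → ℕ) as bs →
  sum (L.map (λ a → sum (L.map (f a) bs)) as) ≡ sum (L.map (λ b → sum (L.map (λ a → f a b) as)) bs)
sum-swap f [] bs = sym (sum-map-0 bs)
sum-swap f (a ∷ as) bs = trans (cong (sum (L.map (f a) bs) +_) (sum-swap f as bs))
  (sym (sum-map-+ (f a) (λ b → sum (L.map (λ a → f a b) as)) bs))

sum-map-++ : ∀ {A : Set} (g : A → ℕ) xs ys → sum (L.map g (xs ++ ys)) ≡ sum (L.map g xs) + sum (L.map g ys)
sum-map-++ g xs ys = trans (cong sum (LP.map-++ g xs ys)) (NLAP.sum-++ (L.map g xs) (L.map g ys))

onesL-map : ∀ {A : Set} (f : A → Bool) xs → onesL (L.map f xs) ≡ sum (L.map (λ x → bit (f x)) xs)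
onesL-map f [] = refl
onesL-map f (x ∷ xs) with f x
... | true = cong suc (onesL-map f xs)
... | false = onesL-map f xs

AtMostOnce : ∀ {A : Set} → (A → Bool) → Set
AtMostOnce p = ∀ a b → p a ≡ true → p b ≡ true → a ≡ b

bit-any : ∀ {A : Set} (p : A → Bool) xs → AllPairs _≢_ xs → AtMostOnce p → bit (any p xs) ≡ sum (L.map (λ x → bit (p x)) xs)
bit-any p [] [] _ = refl
bit-any p (x ∷ xs) (x∉xs ∷ distinct) once with p x in px
... | true = cong suc (sym (none-after xs x∉xs))
  where
  none-after : ∀ ys → All (x ≢_) ys → sum (L.map (λ y → bit (p y)) ys) ≡ 0
  none-after [] [] = refl
  none-after (y ∷ ys) (x≢y ∷ x∉ys) with p y in py
  ... | true = ⊥-elim (x≢y (once x y px py))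
  ... | false = none-after ys x∉ys
... | false = bit-any p xs distinct once

ones-positive : ∀ {k} (v : V.Vec Bool k) u → V.lookup v u ≡ true → 1 ≤ ones v
ones-positive (true V.∷ v) _ _ = s≤s z≤n
ones-positive (false V.∷ v) (F.suc u) vu≡true = ones-positive v u vu≡true

ones-positive⁻ : ∀ {k} (v : V.Vec Bool k) → 1 ≤ ones v → ∃[ u ] V.lookup v u ≡ true
ones-positive⁻ (true V.∷ v) _ = F.zero , refl
ones-positive⁻ (false V.∷ v) 1≤ones = let u , vu≡true = ones-positive⁻ v 1≤ones in F.suc u , vu≡true

ones-sum : ∀ {k} (v : V.Vec Bool k) → ones v ≡ sum (L.map (λ a → bit (V.lookup v a)) (L.allFin k))
ones-sum v = trans (ones-tabulate v) (cong sum (sym (LP.map-tabulate (λ a → a) (λ a → bit (V.lookup v a)))))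
  where
  ones-tabulate : ∀ {k} (v : V.Vec Bool k) → ones v ≡ sum (L.tabulate (λ a → bit (V.lookup v a)))
  ones-tabulate V.[] = refl
  ones-tabulate (true V.∷ v) = cong suc (ones-tabulate v)
  ones-tabulate (false V.∷ v) = ones-tabulate v

onesM-sum : ∀ {k l} (M : V.Vec (V.Vec Bool l) k) → onesM M ≡ sum (L.map (λ u → ones (V.lookup M u)) (L.allFin k))
onesM-sum M = trans (onesM-tabulate M) (cong sum (sym (LP.map-tabulate (λ u → u) (λ u → ones (V.lookup M u)))))
  where
  onesM-tabulate : ∀ {k l} (M : V.Vec (V.Vec Bool l) k) → onesM M ≡ sum (L.tabulate (λ u → ones (V.lookup M u)))
  onesM-tabulate V.[] = refl
  onesM-tabulate (row V.∷ M) = cong (ones row +_) (onesM-tabulate M)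

entry : ∀ {A : Set} {n σ} → V.Vec (V.Vec A σ) n → Fin n → Fin σ → A
entry M u a = V.lookup (V.lookup M u) a

matrix-ext : ∀ {A : Set} {n σ} {M N : V.Vec (V.Vec A σ) n} → (∀ u a → entry M u a ≡ entry N u a) → M ≡ N
matrix-ext M≗N = Pointwise-≡⇒≡ (ext (λ u → Pointwise-≡⇒≡ (ext (M≗N u))))

entry-rO : ∀ {n σ} (T : Table n σ) u a → entry (rO T) u a ≡ is-just (δ T u a)
entry-rO T u a = trans (cong (λ row → V.lookup row a) (VP.lookup-map u (V.map is-just) T)) (VP.lookup-map a is-just (V.lookup T u))

lookup-column : ∀ {n σ} (O : V.Vec (V.Vec Bool σ) n) a u → V.lookup (column O a) u ≡ entry O u a
lookup-column O a u = VP.lookup-map u (λ row → V.lookup row a) O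

ones-column : ∀ {n σ} (O : V.Vec (V.Vec Bool σ) n) a → ones (column O a) ≡ sum (L.map (λ u → bit (entry O u a)) (L.allFin n))
ones-column O a = trans (ones-sum (column O a)) (cong sum (LP.map-cong (λ u → cong bit (lookup-column O a u)) (L.allFin _)))

onesM-columns : ∀ {n σ} (O : V.Vec (V.Vec Bool σ) n) → onesM O ≡ sum (L.map (λ a → ones (column O a)) (L.allFin σ))
onesM-columns {n} {σ} O = begin
  onesM O                                                                 ≡⟨ onesM-sum O ⟩
  sum (L.map (λ u → ones (V.lookup O u)) (L.allFin n))                    ≡⟨ cong sum (LP.map-cong (λ u → ones-sum (V.lookup O u)) (L.allFin n)) ⟩
  sum (L.map (λ u → sum (L.map (λ a → bit (entry O u a)) (L.allFin σ))) (L.allFin n))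
    ≡⟨ sum-swap (λ u a → bit (entry O u a)) (L.allFin n) (L.allFin σ) ⟩
  sum (L.map (λ a → sum (L.map (λ u → bit (entry O u a)) (L.allFin n))) (L.allFin σ))
    ≡⟨ cong sum (LP.map-cong (ones-column O) (L.allFin σ)) ⟨
  sum (L.map (λ a → ones (column O a)) (L.allFin σ))                      ∎
  where open ≡-Reasoning

allFin-sorted : ∀ k → AllPairs F._<_ (L.allFin k)
allFin-sorted k = APP.tabulate⁺-< (λ i<j → i<j)

allFin-distinct : ∀ k → AllPairs _≢_ (L.allFin k)
allFin-distinct k = APP.tabulate⁺ (λ i≢j → i≢j)

Slot : ℕ → ℕ → Set
Slot n σ = Fin σ × Fin n

slotsOver : ∀ {n σ} → List (Fin σ) → List (Slot n σ)
slotsOver [] = []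
slotsOver {n} (a ∷ as) = L.map (a ,_) (L.allFin n) ++ slotsOver as

_<ₛ_ : ∀ {n σ} → Slot n σ → Slot n σ → Set
_<ₛ_ = ×-Lex _≡_ F._<_ F._<_

slotsOver-++ : ∀ {n σ} (as bs : List (Fin σ)) → slotsOver {n} (as ++ bs) ≡ slotsOver as ++ slotsOver bs
slotsOver-++ [] bs = refl
slotsOver-++ {n} (a ∷ as) bs = trans (cong (L.map (a ,_) (L.allFin n) ++_) (slotsOver-++ as bs))
  (sym (LP.++-assoc (L.map (a ,_) (L.allFin n)) _ _))

∈-slotsOver : ∀ {n σ} {a : Fin σ} (u : Fin n) as → a ∈ as → (a , u) ∈ slotsOver as
∈-slotsOver u (a ∷ as) (here refl) = MP.∈-++⁺ˡ (MP.∈-map⁺ (a ,_) (MP.∈-allFin u))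
∈-slotsOver {n} u (b ∷ as) (there a∈) = MP.∈-++⁺ʳ (L.map (b ,_) (L.allFin n)) (∈-slotsOver u as a∈)

slotsOver-∈⁻ : ∀ {n σ} {a : Fin σ} {u : Fin n} as → (a , u) ∈ slotsOver as → a ∈ as
slotsOver-∈⁻ {n} (b ∷ as) s∈ with MP.∈-++⁻ (L.map (b ,_) (L.allFin n)) s∈
... | inj₁ s∈b = let _ , _ , eq = MP.∈-map⁻ (b ,_) s∈b in here (cong proj₁ eq)
... | inj₂ s∈as = there (slotsOver-∈⁻ as s∈as)

slotsOver-sorted : ∀ {n σ} as → AllPairs F._<_ as → AllPairs (_<ₛ_ {n} {σ}) (slotsOver as)
slotsOver-sorted [] [] = []
slotsOver-sorted {n} (a ∷ as) (a<as ∷ s) = APP.++⁺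
  (APP.map⁺ (AllPairs.map (λ u<w → inj₂ (refl , u<w)) (allFin-sorted n)))
  (slotsOver-sorted as s)
  (AllP.map⁺ (All.tabulate (λ _ → All.tabulate (λ t∈ → inj₁ (All.lookup a<as (slotsOver-∈⁻ as t∈))))))

sum-slotsOver : ∀ {n σ} (g : Slot n σ → ℕ) as →
  sum (L.map g (slotsOver as)) ≡ sum (L.map (λ a → sum (L.map (λ u → g (a , u)) (L.allFin n))) as)
sum-slotsOver g [] = refl
sum-slotsOver {n} g (a ∷ as) = trans (sum-map-++ g (L.map (a ,_) (L.allFin n)) (slotsOver as))
  (cong₂ _+_ (cong sum (sym (LP.map-∘ (L.allFin n)))) (sum-slotsOver g as))

δₛ : ∀ {n σ} → Table n σ → Slot n σ → Maybe (Fin n)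
δₛ T (a , u) = δ T u a

targetsOver : ∀ {n σ} → Table n σ → List (Fin σ) → List ℕ
targetsOver T as = values (L.map (δₛ T) (slotsOver as))

targets : ∀ {n σ} → Table n σ → List ℕ
targets T = targetsOver T (L.allFin _)

targetsOver-++ : ∀ {n σ} (T : Table n σ) as bs → targetsOver T (as ++ bs) ≡ targetsOver T as ++ targetsOver T bs
targetsOver-++ T as bs = trans (cong (λ ss → values (L.map (δₛ T) ss)) (slotsOver-++ as bs))
  (trans (cong values (LP.map-++ (δₛ T) (slotsOver as) (slotsOver bs))) (values-++ (L.map (δₛ T) (slotsOver as)) _))

targetsOver-by-letter : ∀ {n σ} (T : Table n σ) as →
  targetsOver T as ≡ L.concat (L.map (λ a → values (L.map (λ u → δ T u a) (L.allFin n))) as)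
targetsOver-by-letter T [] = refl
targetsOver-by-letter {n} T (a ∷ as) = begin
  values (L.map (δₛ T) (L.map (a ,_) (L.allFin n) ++ slotsOver as))
    ≡⟨ cong values (LP.map-++ (δₛ T) (L.map (a ,_) (L.allFin n)) (slotsOver as)) ⟩
  values (L.map (δₛ T) (L.map (a ,_) (L.allFin n)) ++ L.map (δₛ T) (slotsOver as))
    ≡⟨ values-++ (L.map (δₛ T) (L.map (a ,_) (L.allFin n))) _ ⟩
  values (L.map (δₛ T) (L.map (a ,_) (L.allFin n))) ++ targetsOver T as
    ≡⟨ cong₂ _++_ (cong values (LP.map-∘ (L.allFin n))) (sym (targetsOver-by-letter T as)) ⟨
  values (L.map (λ u → δ T u a) (L.allFin n)) ++ L.concat (L.map (λ a → values (L.map (λ u → δ T u a) (L.allFin n))) as) ∎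
  where open ≡-Reasoning

∈-targetsOver : ∀ {n σ} (T : Table n σ) {u a v} as → a ∈ as → δ T u a ≡ just v → toℕ v ∈ targetsOver T as
∈-targetsOver T {u} as a∈ δuav = ∈-values (L.map (δₛ T) (slotsOver as)) (subst (_∈ L.map (δₛ T) (slotsOver as)) δuav (MP.∈-map⁺ (δₛ T) (∈-slotsOver u as a∈)))

∈-targets : ∀ {n σ} (T : Table n σ) {u a v} → δ T u a ≡ just v → toℕ v ∈ targets T
∈-targets {σ = σ} T {a = a} = ∈-targetsOver T (L.allFin σ) (MP.∈-allFin a)

targets-∈⁻ : ∀ {n σ} (T : Table n σ) {i} → i ∈ targets T → ∃[ u ] ∃[ a ] ∃[ v ] δ T u a ≡ just v × toℕ v ≡ i
targets-∈⁻ {σ = σ} T i∈ =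
  let v , v∈ , v≡i = values-∈⁻ (L.map (δₛ T) (slotsOver (L.allFin σ))) i∈
      (a , u) , _ , v≡δ = MP.∈-map⁻ (δₛ T) v∈
  in u , a , v , sym v≡δ , v≡i

All-targetsOver : ∀ {n σ} {P : ℕ → Set} (T : Table n σ) as →
  (∀ {a} u v → a ∈ as → δ T u a ≡ just v → P (toℕ v)) → All P (targetsOver T as)
All-targetsOver T as h = All-values (L.map (δₛ T) (slotsOver as)) (AllP.map⁺ (All.tabulate (λ {s} s∈ v δsv → h (proj₂ s) v (slotsOver-∈⁻ as s∈) δsv)))

length-targetsOver : ∀ {n σ} (T : Table n σ) as → L.length (targetsOver T as) ≡ sum (L.map (λ a → ones (column (rO T) a)) as)
length-targetsOver {n} T as = begin
  L.length (targetsOver T as)                                          ≡⟨ length-values (L.map (δₛ T) (slotsOver as)) ⟩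
  sum (L.map (λ mx → bit (is-just mx)) (L.map (δₛ T) (slotsOver as)))  ≡⟨ cong sum (LP.map-∘ (slotsOver as)) ⟨
  sum (L.map (λ s → bit (is-just (δₛ T s))) (slotsOver as))            ≡⟨ sum-slotsOver _ as ⟩
  sum (L.map (λ a → sum (L.map (λ u → bit (is-just (δ T u a))) (L.allFin n))) as)
    ≡⟨ cong sum (LP.map-cong (λ a → trans (ones-column (rO T) a)
         (cong sum (LP.map-cong (λ u → cong bit (entry-rO T u a)) (L.allFin n)))) as) ⟨
  sum (L.map (λ a → ones (column (rO T) a)) as)                        ∎
  where open ≡-Reasoning

length-targets : ∀ {n σ} (T : Table n σ) → L.length (targets T) ≡ nTrans T
length-targets {σ = σ} T = trans (length-targetsOver T (L.allFin σ)) (sym (onesM-columns (rO T)))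

-- The target list of a WDFA

inDegrees∸1 : ∀ {n' σ} → Table (suc n') σ → List ℕ
inDegrees∸1 {n'} T = L.map (λ v → inDeg T v ∸ 1) (L.drop 1 (L.allFin (suc n')))

rI≡blocks : ∀ {n' σ} (T : Table (suc n') σ) → rI T ≡ blocks (inDegrees∸1 T)
rI≡blocks {n'} T = concatMap-blocks (L.drop 1 (L.allFin (suc n')))
  where
  concatMap-blocks : ∀ vs → L.concatMap (λ v → true ∷ L.replicate (inDeg T v ∸ 1) false) vs ≡ blocks (L.map (λ v → inDeg T v ∸ 1) vs)
  concatMap-blocks [] = refl
  concatMap-blocks (v ∷ vs) = cong (λ bs → true ∷ L.replicate (inDeg T v ∸ 1) false ++ bs) (concatMap-blocks vs)

module Wheeler {n' m σ : ℕ} {T : Table (suc n') σ} (W : IsWDFA (suc n') m σ T) where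
  open IsWDFA W

  letter-unique : ∀ u v → AtMostOnce (λ a → δ T u a pointsTo v)
  letter-unique u v a b δuav δubv with FP.<-cmp a b
  ... | tri< a<b _ _ = ⊥-elim (<-irrefl refl (wheeler-i u u v v a b (pointsTo⇒≡ δuav) (pointsTo⇒≡ δubv) a<b))
  ... | tri≈ _ a≡b _ = a≡b
  ... | tri> _ _ b<a = ⊥-elim (<-irrefl refl (wheeler-i u u v v b a (pointsTo⇒≡ δubv) (pointsTo⇒≡ δuav) b<a))

  inDeg≡count : ∀ v → inDeg T v ≡ count (toℕ v) (targets T)
  inDeg≡count v = begin
    inDeg T v                                                     ≡⟨ onesL-map (λ u → edgeB T u v) (L.allFin (suc n')) ⟩
    sum (L.map (λ u → bit (edgeB T u v)) (L.allFin (suc n')))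
      ≡⟨ cong sum (LP.map-cong (λ u → bit-any _ (L.allFin σ) (allFin-distinct σ) (letter-unique u v)) (L.allFin (suc n'))) ⟩
    sum (L.map (λ u → sum (L.map (λ a → bit (δ T u a pointsTo v)) (L.allFin σ))) (L.allFin (suc n')))
      ≡⟨ sum-swap (λ u a → bit (δ T u a pointsTo v)) (L.allFin (suc n')) (L.allFin σ) ⟩
    sum (L.map (λ a → sum (L.map (λ u → bit (δ T u a pointsTo v)) (L.allFin (suc n')))) (L.allFin σ))
      ≡⟨ sum-slotsOver (λ s → bit (δₛ T s pointsTo v)) (L.allFin σ) ⟨
    sum (L.map (λ s → bit (δₛ T s pointsTo v)) (slotsOver (L.allFin σ)))
      ≡⟨ cong sum (LP.map-∘ (slotsOver (L.allFin σ))) ⟩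
    sum (L.map (λ mx → bit (mx pointsTo v)) (L.map (δₛ T) (slotsOver (L.allFin σ))))
      ≡⟨ count-values v (L.map (δₛ T) (slotsOver (L.allFin σ))) ⟨
    count (toℕ v) (targets T)                                     ∎
    where open ≡-Reasoning

  slot-monotone : ∀ {s t} → s <ₛ t → δₛ T s ≤ᵐ δₛ T t
  slot-monotone {a , u} {b , w} (inj₁ a<b) x δuax y δwby = <⇒≤ (wheeler-i u w x y a b δuax δwby a<b)
  slot-monotone {a , u} {.a , w} (inj₂ (refl , u<w)) x δuax y δway with x FP.≟ y
  ... | yes refl = ≤-refl
  ... | no x≢y = <⇒≤ (wheeler-ii u w x y a δuax δway x≢y u<w)

  targets-sorted : Sorted (targets T)
  targets-sorted = values-sorted (L.map (δₛ T) (slotsOver (L.allFin σ)))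
    (APP.map⁺ (AllPairs.map slot-monotone (slotsOver-sorted (L.allFin σ) (allFin-sorted σ))))

  targets-bounded : All (λ x → 1 ≤ x × x < 1 + n') (targets T)
  targets-bounded = All-targetsOver T (L.allFin σ) (λ {a} u v _ δuav → n≢0⇒n>0 (incoming⇒ v (u , a , δuav)) , FP.toℕ<n v)

  targets-cover : ∀ i → 1 ≤ i → i < 1 + n' → 1 ≤ count i (targets T)
  targets-cover i 1≤i i<n with incoming⇐ (F.fromℕ< i<n) (λ v≡0 → <⇒≢ 1≤i (sym (trans (sym (FP.toℕ-fromℕ< i<n)) v≡0)))
  ... | u , a , δuav = subst (λ j → 1 ≤ count j (targets T)) (FP.toℕ-fromℕ< i<n) (count-∈ (targets T) (∈-targets T δuav))

  inDegrees∸1≡counts : inDegrees∸1 T ≡ L.map (λ i → count i (targets T) ∸ 1) (interval 1 n')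
  inDegrees∸1≡counts = begin
    inDegrees∸1 T                                                ≡⟨ LP.map-tabulate F.suc (λ v → inDeg T v ∸ 1) ⟩
    L.tabulate (λ i → inDeg T (F.suc i) ∸ 1)                ≡⟨ LP.tabulate-cong (λ i → cong (_∸ 1) (inDeg≡count (F.suc i))) ⟩
    L.tabulate (λ i → count (1 + toℕ i) (targets T) ∸ 1)    ≡⟨ tabulate-interval 1 n' (λ i → count i (targets T) ∸ 1) ⟩
    L.map (λ i → count i (targets T) ∸ 1) (interval 1 n')   ∎
    where open ≡-Reasoning

  targets≡runs : targets T ≡ runs 1 (inDegrees∸1 T)
  targets≡runs = trans (sorted-covering⇒runs n' 1 (targets T) targets-sorted targets-bounded targets-cover)
    (cong (runs 1) (sym inDegrees∸1≡counts))

  rI≡changes : rI T ≡ changes 0 (targets T)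
  rI≡changes = trans (rI≡blocks T) (trans (sym (changes-runs 0 (inDegrees∸1 T))) (cong (changes 0) (sym targets≡runs)))

  targets≡decodeRuns : targets T ≡ decodeRuns 0 (rI T)
  targets≡decodeRuns = trans targets≡runs (trans (sym (decodeRuns-blocks 0 (inDegrees∸1 T))) (cong (decodeRuns 0) (sym (rI≡blocks T))))

allFin-suc : ∀ k → L.tabulate {n = k} F.suc ≡ L.map F.suc (L.allFin k)
allFin-suc k = sym (LP.map-tabulate (λ i → i) F.suc)

take-allFin-< : ∀ {σ} (j : Fin σ) → All (F._< j) (L.take (toℕ j) (L.allFin σ))
take-allFin-< F.zero = []
take-allFin-< {suc σ} (F.suc j) = s≤s z≤n ∷ subst (All (F._< F.suc j))
  (sym (trans (cong (L.take (toℕ j)) (allFin-suc σ)) (LP.take-map (toℕ j) (L.allFin σ))))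
  (AllP.map⁺ (All.map s≤s (take-allFin-< j)))

drop-allFin-≥ : ∀ {σ} (j : Fin σ) → All (j F.≤_) (L.drop (toℕ j) (L.allFin σ))
drop-allFin-≥ F.zero = All.tabulate (λ _ → z≤n)
drop-allFin-≥ {suc σ} (F.suc j) = subst (All (F.suc j F.≤_))
  (sym (trans (cong (L.drop (toℕ j)) (allFin-suc σ)) (LP.drop-map (toℕ j) (L.allFin σ))))
  (AllP.map⁺ (All.map s≤s (drop-allFin-≥ j)))

∈-drop-allFin : ∀ {σ} (j : Fin σ) → j ∈ L.drop (toℕ j) (L.allFin σ)
∈-drop-allFin {suc σ} F.zero = here refl
∈-drop-allFin {suc σ} (F.suc j) = subst (F.suc j ∈_)
  (sym (trans (cong (L.drop (toℕ j)) (allFin-suc σ)) (LP.drop-map (toℕ j) (L.allFin σ))))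
  (MP.∈-map⁺ F.suc (∈-drop-allFin j))

module AtLetter {n σ} (T : Table n σ) (j : Fin σ) where

  before after : List (Fin σ)
  before = L.take (toℕ j) (L.allFin σ)
  after = L.drop (toℕ j) (L.allFin σ)

  targets-split : targets T ≡ targetsOver T before ++ targetsOver T after
  targets-split = trans (cong (targetsOver T) (sym (LP.take++drop≡id (toℕ j) (L.allFin σ)))) (targetsOver-++ T before after)

  length-before : L.length (targetsOver T before) ≡ prefixCols (rO T) j
  length-before = length-targetsOver T before

  before-< : ∀ {a} → a ∈ before → a F.< j
  before-< = All.lookup (take-allFin-< j)

  after-≥ : ∀ {a} → a ∈ after → j F.≤ a
  after-≥ = All.lookup (drop-allFin-≥ j)

  before⊎after : ∀ a → a ∈ before ⊎ a ∈ after
  before⊎after a = MP.∈-++⁻ before (subst (a ∈_) (sym (LP.take++drop≡id (toℕ j) (L.allFin σ))) (MP.∈-allFin a))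

-- r maps 𝒟 into ℛ, injectively

r∈ℛ : ∀ {n' m σ} {T : Table (suc n') σ} → IsWDFA (suc n') m σ T → IsR (suc n') m σ (r T)
r∈ℛ {n'} {m} {σ} {T} W = record
  { O-ones = transitions ; O-cols = O-cols ; I-length = I-length ; I-ones = I-ones ; I-O = I-O }
  where
  open IsWDFA W
  open Wheeler W

  I-length : L.length (rI T) ≡ m
  I-length = begin
    L.length (rI T)                ≡⟨ cong L.length (rI≡blocks T) ⟩
    L.length (blocks (inDegrees∸1 T))   ≡⟨ length-blocks 1 (inDegrees∸1 T) ⟩
    L.length (runs 1 (inDegrees∸1 T))   ≡⟨ cong L.length targets≡runs ⟨
    L.length (targets T)           ≡⟨ length-targets T ⟩
    nTrans T                       ≡⟨ transitions ⟩
    m                              ∎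
    where open ≡-Reasoning

  I-ones : onesL (rI T) ≡ suc n' ∸ 1
  I-ones = trans (cong onesL (rI≡blocks T))
    (trans (onesL-blocks (inDegrees∸1 T)) (trans (LP.length-map _ (L.tabulate {n = n'} F.suc)) (LP.length-tabulate F.suc)))

  O-cols : ∀ j → 1 ≤ ones (column (rO T) j)
  O-cols j with effective j
  ... | u , v , δujv = ones-positive (column (rO T) j) u
    (trans (lookup-column (rO T) j u) (trans (entry-rO T u j) (cong is-just δujv)))

  I-O : ∀ j → OneAt (rI T) (prefixCols (rO T) j)
  I-O j with effective j
  ... | u , v , δujv = subst₂ OneAt (sym (trans rI≡changes (cong (changes 0) targets-split))) length-before
    (boundary⁺ (targetsOver T before) (targetsOver T after) (∈-targetsOver T after (∈-drop-allFin j) δujv) increasing)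
    where
    open AtLetter T j
    increasing : All (λ y → 0 < y × All (_< y) (targetsOver T before)) (targetsOver T after)
    increasing = All-targetsOver T after λ {b} w y b∈ δwby →
      n≢0⇒n>0 (incoming⇒ y (w , b , δwby)) ,
      All-targetsOver T before (λ {a} u x a∈ δuax → wheeler-i u w x y a b δuax δwby (<-≤-trans (before-< a∈) (after-≥ b∈)))

table-determined : ∀ {n σ} (T T' : Table n σ) → rO T ≡ rO T' → targets T ≡ targets T' → T ≡ T'
table-determined {n} {σ} T T' rO≡ targets≡ =
  matrix-ext (λ u a → map-≡⇒∈ S slots≡ (∈-slotsOver u (L.allFin σ) (MP.∈-allFin a)))
  where
  S : List (Slot n σ)
  S = slotsOver (L.allFin σ)
  occupancy : ∀ (T : Table n σ) → L.map is-just (L.map (δₛ T) S) ≡ L.map (λ (a , u) → entry (rO T) u a) S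
  occupancy T = trans (sym (LP.map-∘ S)) (LP.map-cong (λ (a , u) → sym (entry-rO T u a)) S)
  slots≡ : L.map (δₛ T) S ≡ L.map (δₛ T') S
  slots≡ = values-injective _ _
    (trans (occupancy T) (trans (cong (λ O → L.map (λ (a , u) → entry O u a) S) rO≡) (sym (occupancy T')))) targets≡

r-injective : ∀ {n' m σ} {T T' : Table (suc n') σ} → IsWDFA (suc n') m σ T → IsWDFA (suc n') m σ T' → r T ≡ r T' → T ≡ T'
r-injective {T = T} {T'} W W' r≡ = table-determined T T' (cong proj₁ r≡)
  (trans (Wheeler.targets≡decodeRuns W) (trans (cong (λ R → decodeRuns 0 (proj₂ R)) r≡) (sym (Wheeler.targets≡decodeRuns W'))))

-- Every (O, I) ∈ ℛ is r of a WDFA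

<ₛ-irrefl : ∀ {n σ} {s : Slot n σ} → ¬ s <ₛ s
<ₛ-irrefl = ×-irreflexive {_≈₁_ = _≡_} {_<₁_ = F._<_} {_≈₂_ = _≡_} {_<₂_ = F._<_} FP.<-irrefl FP.<-irrefl (refl , refl)

<ₛ-asym : ∀ {n σ} {s t : Slot n σ} → s <ₛ t → ¬ t <ₛ s
<ₛ-asym = ×-asymmetric {_≈₁_ = _≡_} {_<₁_ = F._<_} {_<₂_ = F._<_} sym FP.<-resp₂-≡ FP.<-asym FP.<-asym

is-just⇒≡just : ∀ {X : Set} (mx : Maybe X) → is-just mx ≡ true → ∃[ x ] mx ≡ just x
is-just⇒≡just (just x) _ = x , refl

clamp : ∀ k → ℕ → Fin (suc k)
clamp k zero = F.zero
clamp zero (suc x) = F.zero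
clamp (suc k) (suc x) = F.suc (clamp k x)

toℕ-clamp : ∀ k x → x ≤ k → toℕ (clamp k x) ≡ x
toℕ-clamp k zero _ = refl
toℕ-clamp (suc k) (suc x) (s≤s x≤k) = cong suc (toℕ-clamp k x x≤k)

++-split : ∀ {X : Set} (xs : List X) a b → L.length xs ≡ a + b →
  ∃[ ys ] ∃[ zs ] xs ≡ ys ++ zs × L.length ys ≡ a × L.length zs ≡ b
++-split xs zero b len≡ = [] , xs , refl , refl , len≡
++-split (x ∷ xs) (suc a) b len≡ =
  let ys , zs , xs≡ , ys-len , zs-len = ++-split xs a b (suc-injective len≡) in x ∷ ys , zs , cong (x ∷_) xs≡ , cong suc ys-len , zs-len

tabulate-lookup : ∀ {A : Set} {k} (v : V.Vec A k) → L.tabulate (V.lookup v) ≡ V.toList v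
tabulate-lookup V.[] = refl
tabulate-lookup (x V.∷ v) = cong (x ∷_) (tabulate-lookup v)

fillColumn : ∀ {X : Set} {k} → V.Vec Bool k → List X → V.Vec (Maybe X) k × List X
fillColumn V.[] xs = V.[] , xs
fillColumn (false V.∷ p) xs = map₁ (nothing V.∷_) (fillColumn p xs)
fillColumn (true V.∷ p) [] = map₁ (nothing V.∷_) (fillColumn p [])
fillColumn (true V.∷ p) (x ∷ xs) = map₁ (just x V.∷_) (fillColumn p xs)

fillColumns : ∀ {X : Set} {k s} → V.Vec (V.Vec Bool k) s → List X → V.Vec (V.Vec (Maybe X) k) s
fillColumns V.[] xs = V.[]
fillColumns (p V.∷ ps) xs = proj₁ (fillColumn p xs) V.∷ fillColumns ps (proj₂ (fillColumn p xs))

fillColumn-spec : ∀ {n k} (p : V.Vec Bool k) (xs ys : List (Fin n)) → L.length xs ≡ ones p →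
  proj₂ (fillColumn p (xs ++ ys)) ≡ ys × V.map is-just (proj₁ (fillColumn p (xs ++ ys))) ≡ p
    × values (V.toList (proj₁ (fillColumn p (xs ++ ys)))) ≡ L.map toℕ xs
fillColumn-spec V.[] [] ys _ = refl , refl , refl
fillColumn-spec (false V.∷ p) xs ys len≡ =
  let rest , occupied , vals = fillColumn-spec p xs ys len≡ in rest , cong (false V.∷_) occupied , vals
fillColumn-spec (true V.∷ p) (x ∷ xs) ys len≡ =
  let rest , occupied , vals = fillColumn-spec p xs ys (suc-injective len≡) in rest , cong (true V.∷_) occupied , cong (toℕ x ∷_) vals

fillColumns-spec : ∀ {n k s} (ps : V.Vec (V.Vec Bool k) s) (xs : List (Fin n)) → L.length xs ≡ onesM ps →
  (∀ a → V.map is-just (V.lookup (fillColumns ps xs) a) ≡ V.lookup ps a) ×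
  L.concat (L.tabulate (λ a → values (V.toList (V.lookup (fillColumns ps xs) a)))) ≡ L.map toℕ xs
fillColumns-spec V.[] [] _ = (λ ()) , refl
fillColumns-spec (p V.∷ ps) xs len≡ with ++-split xs (ones p) (onesM ps) len≡
... | ys , zs , refl , ys-len , zs-len with fillColumn-spec p ys zs ys-len | fillColumns-spec ps zs zs-len
... | rest , occupied , vals | occupied-rest , vals-rest rewrite rest =
  (λ { F.zero → occupied ; (F.suc a) → occupied-rest a }) ,
  trans (cong₂ _++_ vals vals-rest) (sym (LP.map-++ toℕ ys zs))

IsR⇒blocks : ∀ {n m σ} {O : V.Vec (V.Vec Bool σ) n} {I} → IsR n m σ (O , I) → ∃[ cs ] I ≡ blocks cs
IsR⇒blocks {I = []} _ = [] , refl
IsR⇒blocks {I = true ∷ bs} _ = let c , cs , eq = true∷⇒blocks bs in c ∷ cs , eq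
IsR⇒blocks {σ = zero} {O} {false ∷ bs} R =
  ⊥-elim (1+n≢0 (trans (IsR.I-length R) (trans (sym (IsR.O-ones R)) (onesM-columns O))))
IsR⇒blocks {σ = suc σ} {I = false ∷ bs} R with IsR.I-O R F.zero
... | F.zero , _ , ()
... | F.suc i , () , _

module Reconstruction {n' m σ} (O : V.Vec (V.Vec Bool σ) (suc n')) (I : List Bool) (R : IsR (suc n') m σ (O , I)) where
  open IsR R using (O-ones; O-cols; I-length; I-ones; I-O)

  cs : List ℕ
  cs = proj₁ (IsR⇒blocks R)

  I≡blocks : I ≡ blocks cs
  I≡blocks = proj₂ (IsR⇒blocks R)

  length-cs : L.length cs ≡ n'
  length-cs = trans (sym (onesL-blocks cs)) (trans (cong onesL (sym I≡blocks)) I-ones)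

  decodedTargets : List ℕ
  decodedTargets = runs 1 cs

  decodedTargets-bounded : All (λ x → 1 ≤ x × x < 1 + n') decodedTargets
  decodedTargets-bounded = subst (λ d → All (λ x → 1 ≤ x × x < 1 + d) decodedTargets) length-cs (runs-bounded 1 cs)

  columns : V.Vec (V.Vec Bool (suc n')) σ
  columns = V.tabulate (column O)

  supply : List (Fin (suc n'))
  supply = L.map (clamp n') decodedTargets

  length-supply : L.length supply ≡ onesM columns
  length-supply = begin
    L.length supply                                      ≡⟨ LP.length-map (clamp n') decodedTargets ⟩
    L.length (runs 1 cs)                                 ≡⟨ length-blocks 1 cs ⟨
    L.length (blocks cs)                                 ≡⟨ cong L.length I≡blocks ⟨
    L.length I                                           ≡⟨ I-length ⟩
    m                                                    ≡⟨ O-ones ⟨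
    onesM O                                              ≡⟨ onesM-columns O ⟩
    sum (L.map (λ a → ones (column O a)) (L.allFin σ))
      ≡⟨ trans (onesM-sum columns) (cong sum (LP.map-cong (λ a → cong ones (VP.lookup∘tabulate (column O) a)) (L.allFin σ))) ⟨
    onesM columns                                        ∎
    where open ≡-Reasoning

  filled : V.Vec (V.Vec (Maybe (Fin (suc n'))) (suc n')) σ
  filled = fillColumns columns supply

  filled-occupancy : ∀ a → V.map is-just (V.lookup filled a) ≡ V.lookup columns a
  filled-occupancy = proj₁ (fillColumns-spec columns supply length-supply)

  filled-values : L.concat (L.tabulate (λ a → values (V.toList (V.lookup filled a)))) ≡ L.map toℕ supply
  filled-values = proj₂ (fillColumns-spec columns supply length-supply)

  table : Table (suc n') σ
  table = V.tabulate (λ u → V.tabulate (λ a → V.lookup (V.lookup filled a) u))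

  δ-table : ∀ u a → δ table u a ≡ V.lookup (V.lookup filled a) u
  δ-table u a = trans (cong (λ row → V.lookup row a) (VP.lookup∘tabulate (λ u → V.tabulate (λ a → V.lookup (V.lookup filled a) u)) u))
    (VP.lookup∘tabulate (λ a → V.lookup (V.lookup filled a) u) a)

  rO-table : rO table ≡ O
  rO-table = matrix-ext (λ u a → begin
    entry (rO table) u a                             ≡⟨ entry-rO table u a ⟩
    is-just (δ table u a)                            ≡⟨ cong is-just (δ-table u a) ⟩
    is-just (V.lookup (V.lookup filled a) u)         ≡⟨ VP.lookup-map u is-just (V.lookup filled a) ⟨
    V.lookup (V.map is-just (V.lookup filled a)) u   ≡⟨ cong (λ c → V.lookup c u) (filled-occupancy a) ⟩
    V.lookup (V.lookup columns a) u                  ≡⟨ cong (λ c → V.lookup c u) (VP.lookup∘tabulate (column O) a) ⟩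
    V.lookup (column O a) u                          ≡⟨ lookup-column O a u ⟩
    entry O u a                                      ∎)
    where open ≡-Reasoning

  targets-table : targets table ≡ decodedTargets
  targets-table = begin
    targets table                                                          ≡⟨ targetsOver-by-letter table (L.allFin σ) ⟩
    L.concat (L.map (λ a → values (L.map (λ u → δ table u a) (L.allFin (suc n')))) (L.allFin σ))
      ≡⟨ cong L.concat (trans (LP.map-tabulate (λ a → a) _) (LP.tabulate-cong (λ a → cong values (column-list a)))) ⟩
    L.concat (L.tabulate (λ a → values (V.toList (V.lookup filled a))))  ≡⟨ filled-values ⟩
    L.map toℕ supply                                                       ≡⟨ LP.map-∘ decodedTargets ⟨
    L.map (λ x → toℕ (clamp n' x)) decodedTargets
      ≡⟨ LP.map-id-local (All.map (λ (_ , x<1+n') → toℕ-clamp n' _ (≤-pred x<1+n')) decodedTargets-bounded) ⟩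
    decodedTargets                                                             ∎
    where
    open ≡-Reasoning
    column-list : ∀ a → L.map (λ u → δ table u a) (L.allFin (suc n')) ≡ V.toList (V.lookup filled a)
    column-list a = trans (LP.map-cong (λ u → δ-table u a) (L.allFin (suc n')))
      (trans (LP.map-tabulate (λ u → u) _) (tabulate-lookup (V.lookup filled a)))

  table-sorted : Sorted (targets table)
  table-sorted = subst Sorted (sym targets-table) (runs-sorted 1 cs)

  table-bounded : All (λ x → 1 ≤ x × x < 1 + n') (targets table)
  table-bounded = subst (All _) (sym targets-table) decodedTargets-bounded

  I≡changes : I ≡ changes 0 (targets table)
  I≡changes = trans I≡blocks (trans (sym (changes-runs 0 cs)) (cong (changes 0) (sym targets-table)))

  slot-monotone : ∀ {s t} → s <ₛ t → δₛ table s ≤ᵐ δₛ table t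
  slot-monotone {s} {t} = AllPairs-respects <ₛ-irrefl <ₛ-asym
    (slotsOver-sorted (L.allFin σ) (allFin-sorted σ)) (APP.map⁻ (values-sorted⁻ _ table-sorted))
    (∈-slotsOver (proj₂ s) (L.allFin σ) (MP.∈-allFin (proj₁ s))) (∈-slotsOver (proj₂ t) (L.allFin σ) (MP.∈-allFin (proj₁ t)))

  -- Here I ∈ ℐ_O is used: the 1 at the first slot of letter b separates its targets from all earlier ones.
  wheeler-i : ∀ u v u' v' a b → δ table u a ≡ just u' → δ table v b ≡ just v' → a F.< b → u' F.< v'
  wheeler-i u v u' v' a b δuau' δvbv' a<b =
    All.lookup (All.lookup earlier<later (∈-targetsOver table {v} after (∈-drop-allFin b) δvbv')) u'∈before
    where
    open AtLetter table b
    earlier<later : All (λ y → All (_< y) (targetsOver table before)) (targetsOver table after)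
    earlier<later = boundary⁻ _ _ (subst Sorted targets-split table-sorted)
      (subst₂ OneAt (trans I≡changes (cong (changes 0) targets-split)) (trans (cong (λ O' → prefixCols O' b) (sym rO-table)) (sym length-before)) (I-O b))
    u'∈before : toℕ u' ∈ targetsOver table before
    u'∈before with before⊎after a
    ... | inj₁ a∈ = ∈-targetsOver table {u} before a∈ δuau'
    ... | inj₂ a∈ = ⊥-elim (<-irrefl refl (<-≤-trans a<b (after-≥ a∈)))

  isWDFA : IsWDFA (suc n') m σ table
  isWDFA = record
    { transitions = trans (cong onesM rO-table) O-ones
    ; effective = effective
    ; incoming⇒ = λ v (u , a , δuav) v≡0 → <⇒≢ (proj₁ (All.lookup table-bounded (∈-targets table {u} δuav))) (sym v≡0)
    ; incoming⇐ = incoming⇐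
    ; wheeler-i = wheeler-i
    ; wheeler-ii = λ u v u' v' a δuau' δvav' u'≢v' u<v →
        ≤∧≢⇒< (slot-monotone (inj₂ (refl , u<v)) u' δuau' v' δvav') (λ eq → u'≢v' (FP.toℕ-injective eq))
    }
    where
    effective : ∀ a → ∃[ u ] ∃[ v ] δ table u a ≡ just v
    effective a with ones-positive⁻ (column O a) (O-cols a)
    ... | u , Oua = u , is-just⇒≡just (δ table u a)
      (trans (sym (entry-rO table u a)) (trans (cong (λ O' → entry O' u a) rO-table) (trans (sym (lookup-column O a u)) Oua)))
    incoming⇐ : ∀ v → toℕ v ≢ 0 → ∃[ u ] ∃[ a ] δ table u a ≡ just v
    incoming⇐ v v≢0 with targets-∈⁻ table (subst (toℕ v ∈_) (sym targets-table)
      (runs-covers 1 cs (toℕ v) (n≢0⇒n>0 v≢0) (subst (toℕ v <_) (cong suc (sym length-cs)) (FP.toℕ<n v))))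
    ... | u , a , x , δuax , x≡v = u , a , subst (λ y → δ table u a ≡ just y) (FP.toℕ-injective x≡v) δuax

  r-table : r table ≡ (O , I)
  r-table = cong₂ _,_ rO-table (trans (Wheeler.rI≡changes isWDFA) (trans (cong (changes 0) targets-table) (trans (changes-runs 0 cs) (sym I≡blocks))))

corollary15 : ∀ (n m σ : ℕ) → 1 ≤ n → n ∸ 1 ≤ m → m ≤ n * σ → σ ≤ n ∸ 1 →
    ((T : Table n σ) → IsWDFA n m σ T → IsR n m σ (r T))
    × ((T T' : Table n σ) → IsWDFA n m σ T → IsWDFA n m σ T' → r T ≡ r T' → T ≡ T')
    × ((R : _) → IsR n m σ R → Σ (Table n σ) (λ T → IsWDFA n m σ T × (r T ≡ R)))
corollary15 (suc n') m σ _ _ _ _ =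
  (λ T → r∈ℛ) ,
  (λ T T' → r-injective) ,
  λ (O , I) R → let open Reconstruction O I R in table , isWDFA , r-table
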